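{- If $n$ is a non-negative integer and $s$ is a complex number that is not a negative integer, then \[ \sum_{k = 1}^n \sum_{j = 0}^{k - 1} \frac{(- 1)^j s}{k - j} \binom{s}{n - j} = s\binom{s - 1}{n} H_n + \binom{s - 1}{n} - (- 1)^n. \]
   Context: For complex $s$ and non-negative integer $m$, $\binom{s}{m}=\frac{s(s-1)\cdots(s-m+1)}{m!}$. $H_n=\sum_{i=1}^n\frac1i$. Empty sums are $0$. -}

module Defs where

open import Level using (Level)
open import Data.Nat using (ℕ; zero; suc; _∸_)
open import Algebra.Bundles using (CommutativeRing)

-- We work over an arbitrary
-- commutative ring R in which every positive integer is invertible
-- (a ℚ-algebra, e.g. ℂ).  `inv m` is meant to be the inverse of m+1;
-- the invertibility law is a hypothesis of the theorem.
module QAlg {c ℓ : Level} (R : CommutativeRing c ℓ) (inv : ℕ → CommutativeRing.Carrier R) where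
  open CommutativeRing R

  fromℕ : ℕ → Carrier
  fromℕ zero    = 0#
  fromℕ (suc n) = 1# + fromℕ n

  sgn : ℕ → Carrier
  sgn zero    = 1#
  sgn (suc j) = - sgn j

  sumBelow : ℕ → (ℕ → Carrier) → Carrier
  sumBelow zero    f = 0#
  sumBelow (suc n) f = sumBelow n f + f n

  binom : Carrier → ℕ → Carrier
  binom s zero    = 1#
  binom s (suc m) = (binom s m * (s - fromℕ m)) * inv m

  H : ℕ → Carrier
  H n = sumBelow n (λ i → inv i)

  -- LHS: Σ_{k=1}^n Σ_{j=0}^{k-1} (-1)^j s/(k-j) * binom s (n-j)
  -- (k = k'+1 with k' < n;  1/(k-j) = inv (k' ∸ j) since j ≤ k')
  lhs : Carrier → ℕ → Carrier
  lhs s n = sumBelow n (λ k' → sumBelow (suc k') (λ j →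
              ((sgn j * s) * inv (k' ∸ j)) * binom s (n ∸ j)))

  rhs : Carrier → ℕ → Carrier
  rhs s n = ((s * binom (s - 1#) n) * H n + binom (s - 1#) n) - sgn n

-- Exchanging the order of summation turns the left-hand side into
-- P n = Σ_{j<n} (-1)^j s H_{n-j} binom(s, n-j), which obeys
-- P (n+1) = s H_{n+1} binom(s, n+1) - P n.  The right-hand side plus (-1)^n,
-- T n = s binom(s-1, n) H_n + binom(s-1, n), obeys the same recursion:
-- T (n+1) + T n = s H_{n+1} binom(s, n+1) follows from the absorption identity
-- binom(s, n+1) = s/(n+1) binom(s-1, n) and Pascal's rule
-- binom(s-1, n+1) + binom(s-1, n) = binom(s, n+1).
-- Since P 0 + 1 = 1 = T 0, induction gives P n + (-1)^n = T n.
module Submission where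

open import Level using (Level)
open import Data.Nat using (ℕ; zero; suc; _∸_; _<_)
import Data.Nat.Properties as ℕ
open import Relation.Nullary using (¬_)
import Relation.Binary.PropositionalEquality as ≡
open import Algebra.Bundles using (CommutativeRing)

open import Defs

module QAlgProperties {c ℓ : Level} (R : CommutativeRing c ℓ)
                      (inv : ℕ → CommutativeRing.Carrier R) where
  open CommutativeRing R
  open QAlg R inv
  open import Algebra.Properties.Ring ring
    using (-0#≈0#; -‿+-comm; -‿distribˡ-*; //-rightDividesˡ; //-rightDividesʳ)
  open import Algebra.Properties.CommutativeSemigroup +-commutativeSemigroup
    using () renaming (interchange to +-interchange)
  open import Algebra.Solver.Ring.NaturalCoefficients.Default commutativeSemiring
    using (solve; _:=_; _:+_; _:*_)
  open import Relation.Binary.Reasoning.Setoid setoid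

  sumBelow-cong< : ∀ n {f g : ℕ → Carrier} → (∀ j → j < n → f j ≈ g j) →
                   sumBelow n f ≈ sumBelow n g
  sumBelow-cong< zero    f≈g = refl
  sumBelow-cong< (suc n) f≈g =
    +-cong (sumBelow-cong< n (λ j j<n → f≈g j (ℕ.m<n⇒m<1+n j<n))) (f≈g n ℕ.≤-refl)

  sumBelow-cong : ∀ n {f g : ℕ → Carrier} → (∀ j → f j ≈ g j) →
                  sumBelow n f ≈ sumBelow n g
  sumBelow-cong n f≈g = sumBelow-cong< n (λ j _ → f≈g j)

  sumBelow-+ : ∀ n (f g : ℕ → Carrier) →
               sumBelow n (λ j → f j + g j) ≈ sumBelow n f + sumBelow n g
  sumBelow-+ zero    f g = sym (+-identityˡ 0#)
  sumBelow-+ (suc n) f g = trans (+-congʳ (sumBelow-+ n f g)) (+-interchange _ _ _ _)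

  sumBelow-neg : ∀ n (f : ℕ → Carrier) →
                 sumBelow n (λ j → - f j) ≈ - sumBelow n f
  sumBelow-neg zero    f = sym -0#≈0#
  sumBelow-neg (suc n) f = trans (+-congʳ (sumBelow-neg n f)) (-‿+-comm _ _)

  sumBelow-*ˡ : ∀ n x (f : ℕ → Carrier) →
                sumBelow n (λ j → x * f j) ≈ x * sumBelow n f
  sumBelow-*ˡ zero    x f = sym (zeroʳ x)
  sumBelow-*ˡ (suc n) x f =
    trans (+-congʳ (sumBelow-*ˡ n x f)) (sym (distribˡ x _ _))

  sumBelow-*ʳ : ∀ n x (f : ℕ → Carrier) →
                sumBelow n (λ j → f j * x) ≈ sumBelow n f * x
  sumBelow-*ʳ zero    x f = sym (zeroˡ x)
  sumBelow-*ʳ (suc n) x f =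
    trans (+-congʳ (sumBelow-*ʳ n x f)) (sym (distribʳ x _ _))

  sumBelow-suc : ∀ n (f : ℕ → Carrier) →
                 sumBelow (suc n) f ≈ f 0 + sumBelow n (λ j → f (suc j))
  sumBelow-suc zero    f = +-comm _ _
  sumBelow-suc (suc n) f = trans (+-congʳ (sumBelow-suc n f)) (+-assoc _ _ _)

  sumBelow-triangle : ∀ n (f : ℕ → ℕ → Carrier) →
    sumBelow n (λ k → sumBelow (suc k) (λ j → f j (k ∸ j)))
      ≈ sumBelow n (λ j → sumBelow (n ∸ j) (f j))
  sumBelow-triangle zero    f = refl
  sumBelow-triangle (suc n) f = begin
    sumBelow n (λ k → sumBelow (suc k) (λ j → f j (k ∸ j)))
      + (sumBelow n (λ j → f j (n ∸ j)) + f n (n ∸ n))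
      ≈⟨ +-congʳ (sumBelow-triangle n f) ⟩
    sumBelow n (λ j → sumBelow (n ∸ j) (f j))
      + (sumBelow n (λ j → f j (n ∸ j)) + f n (n ∸ n))
      ≈⟨ +-assoc _ _ _ ⟨
    (sumBelow n (λ j → sumBelow (n ∸ j) (f j)) + sumBelow n (λ j → f j (n ∸ j)))
      + f n (n ∸ n)
      ≈⟨ +-congʳ (sumBelow-+ n _ _) ⟨
    sumBelow n (λ j → sumBelow (suc (n ∸ j)) (f j)) + f n (n ∸ n)
      ≈⟨ +-cong (sumBelow-cong< n suc-∸) (reflexive (≡.cong (f n) (ℕ.n∸n≡0 n))) ⟩
    sumBelow n (λ j → sumBelow (suc n ∸ j) (f j)) + f n 0
      ≈⟨ +-congˡ (+-identityˡ (f n 0)) ⟨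
    sumBelow n (λ j → sumBelow (suc n ∸ j) (f j)) + sumBelow 1 (f n)
      ≈⟨ +-congˡ (reflexive (≡.cong (λ m → sumBelow m (f n)) (ℕ.m+n∸n≡m 1 n))) ⟨
    sumBelow (suc n) (λ j → sumBelow (suc n ∸ j) (f j)) ∎
    where
    suc-∸ : ∀ j → j < n → sumBelow (suc (n ∸ j)) (f j) ≈ sumBelow (suc n ∸ j) (f j)
    suc-∸ j j<n =
      reflexive (≡.cong (λ m → sumBelow m (f j)) (≡.sym (ℕ.+-∸-assoc 1 (ℕ.<⇒≤ j<n))))

  x-[y+z]≈x-y-z : ∀ x y z → x - (y + z) ≈ (x - y) - z
  x-[y+z]≈x-y-z x y z = trans (+-congˡ (sym (-‿+-comm y z))) (sym (+-assoc x (- y) (- z)))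

  binom-absorb : ∀ x n → binom x (suc n) ≈ (x * binom (x - 1#) n) * inv n
  binom-absorb x zero = *-congʳ (begin
    1# * (x - 0#)  ≈⟨ *-comm 1# _ ⟩
    (x - 0#) * 1#  ≈⟨ *-congʳ (trans (+-congˡ -0#≈0#) (+-identityʳ x)) ⟩
    x * 1#         ∎)
  binom-absorb x (suc n) = begin
    (binom x (suc n) * (x - (1# + fromℕ n))) * inv (suc n)
      ≈⟨ *-congʳ (*-cong (binom-absorb x n) (x-[y+z]≈x-y-z x 1# (fromℕ n))) ⟩
    (((x * D) * inv n) * ((x - 1#) - fromℕ n)) * inv (suc n)
      ≈⟨ *-congʳ (rearrange x D (inv n) _) ⟩
    (x * ((D * ((x - 1#) - fromℕ n)) * inv n)) * inv (suc n) ∎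
    where
    D : Carrier
    D = binom (x - 1#) n
    rearrange : ∀ a b c d → ((a * b) * c) * d ≈ a * ((b * d) * c)
    rearrange = solve 4 (λ a b c d → ((a :* b) :* c) :* d := a :* ((b :* d) :* c)) refl

  alternatingSum : Carrier → ℕ → Carrier
  alternatingSum s n = sumBelow n (λ j → ((sgn j * s) * H (n ∸ j)) * binom s (n ∸ j))

  lhs≈alternatingSum : ∀ s n → lhs s n ≈ alternatingSum s n
  lhs≈alternatingSum s n = begin
    lhs s n
      ≈⟨ sumBelow-triangle n (λ j i → ((sgn j * s) * inv i) * binom s (n ∸ j)) ⟩
    sumBelow n (λ j → sumBelow (n ∸ j) (λ i → ((sgn j * s) * inv i) * binom s (n ∸ j)))
      ≈⟨ sumBelow-cong n (λ j → sumBelow-*ʳ (n ∸ j) (binom s (n ∸ j)) _) ⟩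
    sumBelow n (λ j → sumBelow (n ∸ j) (λ i → (sgn j * s) * inv i) * binom s (n ∸ j))
      ≈⟨ sumBelow-cong n (λ j → *-congʳ (sumBelow-*ˡ (n ∸ j) (sgn j * s) inv)) ⟩
    alternatingSum s n ∎

  alternatingSum-suc : ∀ s n →
    alternatingSum s (suc n) ≈ (s * H (suc n)) * binom s (suc n) - alternatingSum s n
  alternatingSum-suc s n = trans (sumBelow-suc n _)
    (+-cong (*-congʳ (*-congʳ (*-identityˡ s)))
            (trans (sumBelow-cong n (λ j → sym (-‿distribˡ-*³ (sgn j) s _ _)))
                   (sumBelow-neg n _)))
    where
    -‿distribˡ-*³ : ∀ a b c d → - (((a * b) * c) * d) ≈ ((- a * b) * c) * d
    -‿distribˡ-*³ a b c d = trans (-‿distribˡ-* _ d)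
      (*-congʳ (trans (-‿distribˡ-* _ c) (*-congʳ (-‿distribˡ-* a b))))

  rhsCore : Carrier → ℕ → Carrier
  rhsCore s n = (s * binom (s - 1#) n) * H n + binom (s - 1#) n

  module _ (inv-correct : ∀ m → fromℕ (suc m) * inv m ≈ 1#) where

    binom-pascal : ∀ x n → binom (x - 1#) (suc n) + binom (x - 1#) n ≈ binom x (suc n)
    binom-pascal x n = begin
      (D * u) * inv n + D
        ≈⟨ +-congˡ (trans (*-congˡ (inv-correct n)) (*-identityʳ D)) ⟨
      (D * u) * inv n + D * (fromℕ (suc n) * inv n)
        ≈⟨ factor D u (fromℕ (suc n)) (inv n) ⟩
      (D * (u + fromℕ (suc n))) * inv n
        ≈⟨ *-congʳ (trans (*-congˡ u+[n+1]≈x) (*-comm D x)) ⟩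
      (x * D) * inv n
        ≈⟨ binom-absorb x n ⟨
      binom x (suc n) ∎
      where
      D u : Carrier
      D = binom (x - 1#) n
      u = (x - 1#) - fromℕ n
      u+[n+1]≈x : u + fromℕ (suc n) ≈ x
      u+[n+1]≈x = trans (+-congʳ (sym (x-[y+z]≈x-y-z x 1# (fromℕ n))))
                        (//-rightDividesˡ (fromℕ (suc n)) x)
      factor : ∀ a b c d → (a * b) * d + a * (c * d) ≈ (a * (b + c)) * d
      factor = solve 4 (λ a b c d → (a :* b) :* d :+ a :* (c :* d) := (a :* (b :+ c)) :* d) refl

    rhsCore-suc+rhsCore : ∀ s n →
      rhsCore s (suc n) + rhsCore s n ≈ (s * H (suc n)) * binom s (suc n)
    rhsCore-suc+rhsCore s n = begin
      (a + D′) + (b + D)                    ≈⟨ +-interchange _ _ _ _ ⟩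
      (a + b) + (D′ + D)                    ≈⟨ +-congˡ (binom-pascal s n) ⟩
      (a + b) + binom s (suc n)             ≈⟨ +-congˡ (binom-absorb s n) ⟩
      (a + b) + (s * D) * inv n             ≈⟨ expand s D′ D (H n) (inv n) ⟨
      (s * H (suc n)) * (D′ + D)            ≈⟨ *-congˡ (binom-pascal s n) ⟩
      (s * H (suc n)) * binom s (suc n)     ∎
      where
      D′ D a b : Carrier
      D′ = binom (s - 1#) (suc n)
      D  = binom (s - 1#) n
      a  = (s * D′) * H (suc n)
      b  = (s * D) * H n
      expand : ∀ x d′ d h i →
        (x * (h + i)) * (d′ + d) ≈ ((x * d′) * (h + i) + (x * d) * h) + (x * d) * i
      expand = solve 5 (λ x d′ d h i → (x :* (h :+ i)) :* (d′ :+ d)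
                         := ((x :* d′) :* (h :+ i) :+ (x :* d) :* h) :+ (x :* d) :* i) refl

    alternatingSum+sgn≈rhsCore : ∀ s n → alternatingSum s n + sgn n ≈ rhsCore s n
    alternatingSum+sgn≈rhsCore s zero    = +-congʳ (sym (zeroʳ (s * 1#)))
    alternatingSum+sgn≈rhsCore s (suc n) = begin
      alternatingSum s (suc n) + - sgn n
        ≈⟨ +-congʳ (alternatingSum-suc s n) ⟩
      (leading - alternatingSum s n) + - sgn n
        ≈⟨ +-assoc _ _ _ ⟩
      leading + (- alternatingSum s n + - sgn n)
        ≈⟨ +-congˡ (-‿+-comm _ _) ⟩
      leading - (alternatingSum s n + sgn n)
        ≈⟨ +-congˡ (-‿cong (alternatingSum+sgn≈rhsCore s n)) ⟩
      leading - rhsCore s n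
        ≈⟨ +-congʳ (rhsCore-suc+rhsCore s n) ⟨
      (rhsCore s (suc n) + rhsCore s n) - rhsCore s n
        ≈⟨ //-rightDividesʳ (rhsCore s n) (rhsCore s (suc n)) ⟩
      rhsCore s (suc n) ∎
      where
      leading : Carrier
      leading = (s * H (suc n)) * binom s (suc n)

    lhs≈rhs : ∀ s n → lhs s n ≈ rhs s n
    lhs≈rhs s n = begin
      lhs s n                                ≈⟨ lhs≈alternatingSum s n ⟩
      alternatingSum s n                     ≈⟨ //-rightDividesʳ (sgn n) _ ⟨
      (alternatingSum s n + sgn n) - sgn n   ≈⟨ +-congʳ (alternatingSum+sgn≈rhsCore s n) ⟩
      rhs s n                                ∎

proposition21 : ∀ {c ℓ : Level} (R : CommutativeRing c ℓ)
  (inv : ℕ → CommutativeRing.Carrier R) →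
  let open CommutativeRing R
      open QAlg R inv
  in (∀ m → fromℕ (suc m) * inv m ≈ 1#) →
     (s : Carrier) → (∀ m → ¬ (s ≈ - fromℕ (suc m))) →
     (n : ℕ) → lhs s n ≈ rhs s n
proposition21 R inv inv-correct s _ = QAlgProperties.lhs≈rhs R inv inv-correct s
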